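{- Let $G_\bullet$ be a transitive $\mathrm{FI}$-graph. Then for $n\gg0$, $G_n$ is not bipartite. In particular, the simple random walk on $G_n$ is aperiodic for $n\gg0$.
   Context: $\mathrm{FI}$ is the category of the sets $[n]=\{1,\dots,n\}$ with injections. An $\mathrm{FI}$-set is a functor $Z_\bullet$ from $\mathrm{FI}$ to finite sets ($Z_n$ carries an $\mathfrak{S}_n$-action); it is finitely generated in degree $\le d$ if for all $n\ge d$, $Z_{n+1}$ is the union of the images of $Z_n$ under the maps induced by all injections $[n]\hookrightarrow[n+1]$. An $\mathrm{FI}$-graph $G_\bullet$ is a functor from $\mathrm{FI}$ to finite graphs and graph homomorphisms, i.e. a vertex $\mathrm{FI}$-set $V_\bullet$ with a symmetric edge relation $E_\bullet\subseteq V_\bullet\times V_\bullet$ (a sub-$\mathrm{FI}$-set); all graphs are assumed connected. $G_\bullet$ is transitive if it is finitely generated (its vertex $\mathrm{FI}$-set is finitely generated) and $\mathfrak{S}_n$ acts transitively on $V_n$ for all $n\gg0$. The simple random walk moves from a vertex to a uniformly random neighbor. -}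

module Defs where

open import Data.Nat using (ℕ; zero; suc; _≤_)
open import Data.Nat.Divisibility using (_∣_)
open import Data.Fin using (Fin)
open import Data.Bool using (Bool; true; false)
open import Data.Product using (Σ; ∃; ∃-syntax; _×_; _,_)
open import Function using (_∘_; id)
open import Function.Definitions using (Injective)
open import Relation.Binary.PropositionalEquality using (_≡_)
open import Relation.Nullary using (¬_)

Inj : ℕ → ℕ → Set
Inj n m = Σ (Fin n → Fin m) (Injective _≡_ _≡_)

-- An FI-graph: vertex FI-set V_n = Fin (size n) (a finite set), functorial
-- action of injections, and a symmetric edge relation E_n ⊆ V_n × V_n
-- (given by its characteristic function) which is a sub-FI-set,
-- i.e. every induced map is a graph homomorphism.
record FIGraph : Set₁ where
  field
    size   : ℕ → ℕ
  Vert : ℕ → Set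
  Vert n = Fin (size n)
  field
    act    : ∀ {n m} → Inj n m → Vert n → Vert m
    act-ext : ∀ {n m} (f g : Inj n m) → (∀ i → Σ.proj₁ f i ≡ Σ.proj₁ g i) →
              ∀ x → act f x ≡ act g x
    act-id : ∀ {n} (p : Injective _≡_ _≡_ (id {A = Fin n})) (x : Vert n) →
             act (id , p) x ≡ x
    act-∘  : ∀ {n m k} (f : Inj n m) (g : Inj m k)
               (r : Injective _≡_ _≡_ (Σ.proj₁ g ∘ Σ.proj₁ f)) (x : Vert n) →
             act (Σ.proj₁ g ∘ Σ.proj₁ f , r) x ≡ act g (act f x)
    adj     : ∀ {n} → Vert n → Vert n → Bool
    adj-sym : ∀ {n} (x y : Vert n) → adj x y ≡ adj y x
    adj-act : ∀ {n m} (f : Inj n m) (x y : Vert n) →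
              adj x y ≡ true → adj (act f x) (act f y) ≡ true

module _ (G : FIGraph) where
  open FIGraph G

  data Walk {n : ℕ} : Vert n → Vert n → ℕ → Set where
    nil  : ∀ x → Walk x x 0
    cons : ∀ {x y z k} → adj x y ≡ true → Walk y z k → Walk x z (suc k)

  Connected : ℕ → Set
  Connected n = ∀ (x y : Vert n) → ∃[ k ] Walk x y k

  HasEdge : ℕ → Set
  HasEdge n = ∃[ x ] ∃[ y ] adj {n} x y ≡ true

  Bipartite : ℕ → Set
  Bipartite n = Σ (Vert n → Bool) λ c →
    ∀ (x y : Vert n) → adj x y ≡ true → ¬ (c x ≡ c y)

  GeneratedInDegree≤ : ℕ → Set
  GeneratedInDegree≤ d = ∀ n → d ≤ n → ∀ (y : Vert (suc n)) →
    ∃[ f ] ∃[ x ] act {n} {suc n} f x ≡ y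

  FinitelyGenerated : Set
  FinitelyGenerated = ∃[ d ] GeneratedInDegree≤ d

  -- 𝔖_n acts transitively on V_n (permutations of [n] = injections [n] ↪ [n])
  SymTransitive : ℕ → Set
  SymTransitive n = ∀ (x y : Vert n) → ∃[ σ ] act {n} {n} σ x ≡ y

  Transitive : Set
  Transitive = FinitelyGenerated × ∃[ N ] (∀ n → N ≤ n → SymTransitive n)

  -- the simple random walk on G_n is aperiodic: for every vertex v the
  -- gcd of {t | P^t(v,v) > 0} = {t | there is a closed walk of length t at v}
  -- equals 1, i.e. no d ≥ 2 divides all such t
  Aperiodic : ℕ → Set
  Aperiodic n = ∀ (v : Vert n) (d : ℕ) → 2 ≤ d →
    ¬ (∀ t → Walk v v t → d ∣ t)

{-# OPTIONS --safe #-}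
-- Pick an edge a – b of G_m and σ ∈ 𝔖_m with σ a = b. For any k with G_k
-- nonempty, the permutation σ ⊕ id of [m + k] acts on G_{m+k} as a graph
-- endomorphism that moves the image of a to the adjacent image of b, but fixes
-- every vertex coming from the last k points. In a connected bipartite graph an endomorphism with a fixed
-- point preserves the colour of every vertex, so it cannot move a vertex to a
-- neighbour. Aperiodicity follows since a connected graph whose closed walks
-- at v all have even length is 2-coloured by the parity of walk lengths from v.
module Submission where

open import Defs
open import Data.Nat using (ℕ; suc; _≤_; _+_; _∸_; _⊔_; parity)
open import Data.Nat.Properties
  using (≤-antisym; m+[n∸m]≡n; m≤m⊔n; m≤n⊔m; m+n≤o⇒m≤o∸n; m+n≤o⇒m≤o; m+n≤o⇒n≤o)
open import Data.Nat.Divisibility using (_∣_; divides; ∣⇒≤)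
open import Data.Parity using (Parity; 0ℙ; 1ℙ; _⁻¹)
import Data.Parity as ℙ
open import Data.Parity.Properties
  using (+-homo-+; *-homo-*; *-zeroʳ; suc-homo-⁻¹; ⁻¹-selfInverse; p+p⁻¹≡1ℙ)
open import Data.Fin using (splitAt; join; _↑ˡ_; _↑ʳ_)
open import Data.Fin.Properties
  using (splitAt-join; join-splitAt; splitAt-↑ˡ; splitAt-↑ʳ; ↑ˡ-injective; ↑ʳ-injective)
open import Data.Sum using (inj₁; inj₂)
import Data.Sum as Sum
open import Data.Sum.Properties using (inj₁-injective)
open import Data.Bool using (Bool; true; false; not)
open import Data.Bool.Properties using (¬-not; not-injective)
open import Data.Product using (Σ; ∃-syntax; _×_; _,_; proj₁; proj₂)
open import Function using (_∘_; id)
open import Function.Definitions using (Injective)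
open import Relation.Binary.PropositionalEquality
  using (_≡_; refl; sym; trans; cong; cong₂; subst; module ≡-Reasoning)
open import Relation.Nullary using (¬_)

infixr 9 _∘ᴵ_

_∘ᴵ_ : ∀ {a b c} → Inj b c → Inj a b → Inj a c
(g , g-inj) ∘ᴵ (f , f-inj) = g ∘ f , f-inj ∘ g-inj

inl : ∀ {m} k → Inj m (m + k)
inl k = (_↑ˡ k) , ↑ˡ-injective k _ _

inr : ∀ m {k} → Inj k (m + k)
inr m = (m ↑ʳ_) , ↑ʳ-injective m _ _

map₁-injective : ∀ {A B : Set} {f : A → A} → Injective _≡_ _≡_ f →
  Injective _≡_ _≡_ (Sum.map {B = B} f id)
map₁-injective f-inj {inj₁ _} {inj₁ _} eq = cong inj₁ (f-inj (inj₁-injective eq))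
map₁-injective f-inj {inj₂ _} {inj₂ _} refl = refl

splitAt-injective : ∀ m {k} → Injective _≡_ _≡_ (splitAt m {k})
splitAt-injective m {k} {i} {j} eq =
  trans (sym (join-splitAt m k i)) (trans (cong (join m k) eq) (join-splitAt m k j))

join-injective : ∀ m k → Injective _≡_ _≡_ (join m k)
join-injective m k {u} {v} eq =
  trans (sym (splitAt-join m k u)) (trans (cong (splitAt m) eq) (splitAt-join m k v))

_⊕id_ : ∀ {m} → Inj m m → ∀ k → Inj (m + k) (m + k)
_⊕id_ {m} (σ , σ-inj) k =
  join m k ∘ Sum.map σ id ∘ splitAt m ,
  splitAt-injective m ∘ map₁-injective σ-inj ∘ join-injective m k

isOdd : Parity → Bool
isOdd 0ℙ = false
isOdd 1ℙ = true

isOdd-injective : Injective _≡_ _≡_ isOdd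
isOdd-injective {0ℙ} {0ℙ} _ = refl
isOdd-injective {1ℙ} {1ℙ} _ = refl

parity-suc : ∀ n → parity (suc n) ≡ parity n ⁻¹
parity-suc n = sym (⁻¹-selfInverse (suc-homo-⁻¹ n))

parity-odd-sum : ∀ a b → parity a ≡ parity b → parity (a + suc b) ≡ 1ℙ
parity-odd-sum a b eq = begin
  parity (a + suc b)            ≡⟨ +-homo-+ a (suc b) ⟩
  parity a ℙ.+ parity (suc b)   ≡⟨ cong₂ ℙ._+_ eq (parity-suc b) ⟩
  parity b ℙ.+ parity b ⁻¹      ≡⟨ p+p⁻¹≡1ℙ (parity b) ⟩
  1ℙ                            ∎
  where open ≡-Reasoning

parity-2∣ : ∀ {t} → 2 ∣ t → parity t ≡ 0ℙ
parity-2∣ (divides q refl) = trans (*-homo-* q 2) (*-zeroʳ (parity q))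

module _ (G : FIGraph) where
  open FIGraph G

  infixr 5 _++ʷ_

  _++ʷ_ : ∀ {n} {x y z : Vert n} {a b} → Walk G x y a → Walk G y z b → Walk G x z (a + b)
  nil _    ++ʷ q = q
  cons e p ++ʷ q = cons e (p ++ʷ q)

  snocʷ : ∀ {n} {x y z : Vert n} {a} → Walk G x y a → adj y z ≡ true → Walk G x z (suc a)
  snocʷ (nil _)    e = cons e (nil _)
  snocʷ (cons e p) f = cons e (snocʷ p f)

  reverseʷ : ∀ {n} {x y : Vert n} {a} → Walk G x y a → Walk G y x a
  reverseʷ (nil x)            = nil x
  reverseʷ (cons {x} {y} e p) = snocʷ (reverseʷ p) (trans (adj-sym y x) e)

  has-neighbour : ∀ {n} → Connected G n → HasEdge G n → (v : Vert n) →
    Σ (Vert n) λ u → adj v u ≡ true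
  has-neighbour conn (a , b , ab) v with conn v a
  ... | _ , nil _    = b , ab
  ... | _ , cons e _ = _ , e

  colour-preserved-along-walk : ∀ {n} ((c , _) : Bipartite G n) (h : Vert n → Vert n) →
    (∀ x y → adj x y ≡ true → adj (h x) (h y) ≡ true) →
    ∀ {w z l} → Walk G w z l → c (h w) ≡ c w → c (h z) ≡ c z
  colour-preserved-along-walk _ h h-hom (nil _) eq = eq
  colour-preserved-along-walk bip@(c , proper) h h-hom (cons {x} {y} e p) eq =
    colour-preserved-along-walk bip h h-hom p (not-injective (begin
      not (c (h y)) ≡⟨ sym (¬-not (proper (h x) (h y) (h-hom x y e))) ⟩
      c (h x)       ≡⟨ eq ⟩
      c x           ≡⟨ ¬-not (proper x y e) ⟩
      not (c y)     ∎))
    where open ≡-Reasoning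

  endomorphism-moving-along-edge⇒¬Bipartite : ∀ {n} → Connected G n →
    (h : Vert n → Vert n) → (∀ x y → adj x y ≡ true → adj (h x) (h y) ≡ true) →
    (w : Vert n) → h w ≡ w → (x : Vert n) → adj x (h x) ≡ true → ¬ Bipartite G n
  endomorphism-moving-along-edge⇒¬Bipartite conn h h-hom w hw≡w x x~hx bip@(c , proper) =
    proper x (h x) x~hx
      (sym (colour-preserved-along-walk bip h h-hom (proj₂ (conn w x)) (cong c hw≡w)))

  act-∘≗ : ∀ {a b d} (f : Inj a b) (g : Inj b d) (h : Inj a d) →
    (∀ i → proj₁ g (proj₁ f i) ≡ proj₁ h i) → ∀ x → act g (act f x) ≡ act h x
  act-∘≗ f g h eq x = trans (sym (act-∘ f g (proj₂ (g ∘ᴵ f)) x)) (act-ext (g ∘ᴵ f) h eq x)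

  act-⊕id-inl : ∀ {m} (σ : Inj m m) k (x : Vert m) →
    act (σ ⊕id k) (act (inl k) x) ≡ act (inl k) (act σ x)
  act-⊕id-inl {m} σ k x =
    trans (act-∘≗ (inl k) (σ ⊕id k) (inl k ∘ᴵ σ)
            (λ i → cong (join m k ∘ Sum.map (proj₁ σ) id) (splitAt-↑ˡ m i k)) x)
          (sym (act-∘≗ σ (inl k) (inl k ∘ᴵ σ) (λ _ → refl) x))

  act-⊕id-inr : ∀ {m} (σ : Inj m m) k (u : Vert k) →
    act (σ ⊕id k) (act (inr m) u) ≡ act (inr m) u
  act-⊕id-inr {m} σ k u =
    act-∘≗ (inr m) (σ ⊕id k) (inr m)
      (λ i → cong (join m k ∘ Sum.map (proj₁ σ) id) (splitAt-↑ʳ m k i)) u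

  ¬Bipartite-+ : ∀ {m k} → HasEdge G m → SymTransitive G m → Vert k →
    Connected G (m + k) → ¬ Bipartite G (m + k)
  ¬Bipartite-+ {m} {k} (a , b , a~b) transitive u conn =
    endomorphism-moving-along-edge⇒¬Bipartite conn
      (act (σ ⊕id k)) (adj-act (σ ⊕id k))
      (act (inr m) u) (act-⊕id-inr σ k u)
      (act (inl k) a) moved-along-edge
    where
    σ : Inj m m
    σ = proj₁ (transitive a b)
    moved-along-edge : adj (act (inl k) a) (act (σ ⊕id k) (act (inl k) a)) ≡ true
    moved-along-edge
      rewrite act-⊕id-inl σ k a | proj₂ (transitive a b) = adj-act (inl k) a b a~b

  even-closed-walks⇒Bipartite : ∀ {n} → Connected G n → (v : Vert n) →
    (∀ t → Walk G v v t → parity t ≡ 0ℙ) → Bipartite G n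
  even-closed-walks⇒Bipartite {n} conn v even = colour , proper
    where
    colour : Vert n → Bool
    colour z = isOdd (parity (proj₁ (conn v z)))
    proper : ∀ x y → adj x y ≡ true → ¬ (colour x ≡ colour y)
    proper x y x~y same with conn v x | conn v y
    ... | a , p | b , q
      with () ← trans (sym (parity-odd-sum a b (isOdd-injective same)))
                      (even _ (p ++ʷ cons x~y (reverseʷ q)))

  ¬Bipartite⇒Aperiodic : ∀ {n} → Connected G n → HasEdge G n → ¬ Bipartite G n →
    Aperiodic G n
  ¬Bipartite⇒Aperiodic conn edge ¬bip v d 2≤d d∣closed =
    ¬bip (even-closed-walks⇒Bipartite conn v λ t w → parity-2∣ (subst (_∣ t) d≡2 (d∣closed t w)))
    where
    back-and-forth : Walk G v v 2
    back-and-forth with u , v~u ← has-neighbour conn edge v =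
      cons v~u (cons (trans (adj-sym u v) v~u) (nil v))
    d≡2 : d ≡ 2
    d≡2 = ≤-antisym (∣⇒≤ (d∣closed 2 back-and-forth)) 2≤d

proposition4p2 : (G : FIGraph) →
    (∀ n → Connected G n) →
    (∃[ M ] (∀ n → M ≤ n → HasEdge G n)) →
    Transitive G →
    ∃[ N ] (∀ n → N ≤ n → ¬ Bipartite G n × Aperiodic G n)
proposition4p2 G conn (M , edge) (_ , T , transitive) = M + m , λ n M+m≤n →
  let ¬bip : ¬ Bipartite G n
      ¬bip = subst (λ l → ¬ Bipartite G l) (m+[n∸m]≡n (m+n≤o⇒n≤o M M+m≤n))
               (¬Bipartite-+ G (edge m (m≤m⊔n M T)) (transitive m (m≤n⊔m M T))
                 (proj₁ (edge (n ∸ m) (m+n≤o⇒m≤o∸n M M+m≤n))) (conn _))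
  in ¬bip , ¬Bipartite⇒Aperiodic G (conn n) (edge n (m+n≤o⇒m≤o M M+m≤n)) ¬bip
  where
  m : ℕ
  m = M ⊔ T
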